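{- Let $F$ be the star tree consisting of a root joined to $b$ leaves by edges of weight $1$, with $b$ fixed, and let $R$ and $B$ be two independent random $n$-element submultisets of the leaves of $F$. Then for large $n$ the expected cost of the optimal bichromatic tour on $R$ and $B$ is $\Theta(\sqrt{n})$.
   Context: A random $n$-element submultiset of the leaves is obtained by choosing $n$ leaves independently and uniformly at random (repetitions allowed); points at the same leaf are at distance $0$, and points at distinct leaves are at distance $2$ (the path length in $F$). A bichromatic tour is a Hamiltonian cycle on $R\cup B$ in which every edge joins a point of $R$ to a point of $B$; its cost is the sum of the distances of its edges, and the optimal bichromatic tour is one of minimum cost. -}

module Defs where

open import Data.Nat using (ℕ; zero; suc; _+_; _*_; _⊓_)
open import Data.Fin using (Fin)
open import Data.Fin.Properties using (_≟_)
open import Data.List using (List; []; _∷_; map; concatMap; foldr)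
open import Data.Nat.ListAction using (sum)
open import Data.Vec using (Vec; toList)
import Data.Vec as V
open import Relation.Nullary using (yes; no)

-- Leaves of the star tree F with b leaves are Fin b.
-- Tree distance between leaves: 0 if equal, 2 (leaf-root-leaf) otherwise.
dist : {b : ℕ} → Fin b → Fin b → ℕ
dist x y with x ≟ y
... | yes _ = 0
... | no  _ = 2

insertions : {A : Set} → A → List A → List (List A)
insertions x []       = (x ∷ []) ∷ []
insertions x (y ∷ ys) = (x ∷ y ∷ ys) ∷ map (y ∷_) (insertions x ys)

perms : {A : Set} → List A → List (List A)
perms []       = [] ∷ []
perms (x ∷ xs) = concatMap (insertions x) (perms xs)

-- Cost of the alternating cycle r0 b0 r1 b1 ... r(n-1) b(n-1) r0
-- (f is the first red point, to close the cycle).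
cycleGo : {b : ℕ} → List (Fin b) → List (Fin b) → Fin b → ℕ
cycleGo (r ∷ r' ∷ rs) (x ∷ xs) f = dist r x + dist x r' + cycleGo (r' ∷ rs) xs f
cycleGo (r ∷ [])      (x ∷ _)  f = dist r x + dist x f
cycleGo _             _        _ = 0

cycleCost : {b : ℕ} → List (Fin b) → List (Fin b) → ℕ
cycleCost []       _  = 0
cycleCost (r ∷ rs) xs = cycleGo (r ∷ rs) xs r

minList : List ℕ → ℕ
minList []       = 0
minList (x ∷ xs) = foldr _⊓_ x xs

optTour : {b n : ℕ} → Vec (Fin b) n → Vec (Fin b) n → ℕ
optTour R B =
  minList (concatMap (λ rs → map (λ bs → cycleCost rs bs) (perms (toList B)))
                     (perms (toList R)))

-- All sequences of n leaves (the uniform sample space of n i.i.d. leaves).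
allVecs : (b n : ℕ) → List (Vec (Fin b) n)
allVecs b zero    = V.[] ∷ []
allVecs b (suc n) =
  concatMap (λ v → map (λ i → i V.∷ v) (Data.List.allFin b)) (allVecs b n)

-- Sum of the optimal tour cost over all b^n * b^n equally likely outcomes;
-- expected cost = totalCost b n / b^(2n).
totalCost : (b n : ℕ) → ℕ
totalCost b n =
  sum (concatMap (λ R → map (λ B → optTour R B) (allVecs b n)) (allVecs b n))

module Submission where

-- Fix a leaf z and let D be the number of red minus blue points at z. A bichromatic tour passes each point with two
-- edges, and the potential 2·[x = z] changes by at most the length of an edge, so every tour costs at least 4|D|.
-- Conversely, visiting the points shared by both colours leaf by leaf and then the excess points gives a tour of cost
-- at most 4 Σ_z |D_z| + 4b + 4. Hence the expected optimal cost is Θ(E|D|). Adding one point of each colour is a lazy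
-- step ±1 of D, which gives E D² and E D⁴ exactly (of orders n and n²); then E|D| ≤ (E D²)^(1/2) = O(√n) and, by
-- Hölder, E|D| ≥ (E D²)^(3/2) / (E D⁴)^(1/2) = Ω(√n).

open import Defs
open import Data.Nat using (ℕ; zero; suc; _+_; _*_; _^_; _∸_; _⊓_; _≤_; _<_; z≤n; s≤s; ∣_-_∣; >-nonZero)
open import Data.Nat.Properties hiding (_≟_)
open import Data.Nat.Tactic.RingSolver using (solve-∀)
open import Data.Nat.ListAction using (sum)
open import Data.Nat.ListAction.Properties using (sum-++; sum-↭)
open import Data.Fin using (Fin; zero; suc)
open import Data.Fin.Properties using (_≟_)
open import Data.List using (List; []; _∷_; _++_; map; concatMap; foldr; length; replicate; allFin)
import Data.List.Properties as List
open import Data.List.Membership.Propositional using (_∈_; find; lose)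
open import Data.List.Membership.Propositional.Properties
  using (∈-map⁺; ∈-map⁻; ∈-concatMap⁺; ∈-concatMap⁻; ∈-∃++)
open import Data.List.Relation.Unary.Any using (here; there)
open import Data.List.Relation.Binary.Permutation.Propositional
  using (_↭_; ↭-refl; ↭-trans; ↭-prep; ↭-swap)
open import Data.List.Relation.Binary.Permutation.Propositional.Properties using (↭-length; map⁺)
open import Data.Vec using (Vec; toList)
import Data.Vec as Vec
open import Data.Vec.Properties using (length-toList)
open import Data.Product using (_×_; _,_; proj₁; proj₂; ∃-syntax; uncurry)
open import Data.Sum using (inj₁; inj₂)
open import Data.Empty using (⊥-elim)
open import Function using (_∘_)
open import Relation.Nullary using (Dec; yes; no)
open import Relation.Binary.PropositionalEquality
open import Algebra.Properties.CommutativeSemigroup +-commutativeSemigroup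
  using () renaming (interchange to +-interchange; x∙yz≈y∙xz to m+[n+o]≡n+[m+o])

private
  variable
    A B : Set
    b n : ℕ

sumMap : (A → ℕ) → List A → ℕ
sumMap f xs = sum (map f xs)

sumMap-cong : ∀ {f g : A → ℕ} xs → (∀ x → f x ≡ g x) → sumMap f xs ≡ sumMap g xs
sumMap-cong []       f≡g = refl
sumMap-cong (x ∷ xs) f≡g = cong₂ _+_ (f≡g x) (sumMap-cong xs f≡g)

sumMap-mono : ∀ {f g : A → ℕ} xs → (∀ x → f x ≤ g x) → sumMap f xs ≤ sumMap g xs
sumMap-mono []       f≤g = z≤n
sumMap-mono (x ∷ xs) f≤g = +-mono-≤ (f≤g x) (sumMap-mono xs f≤g)

sumMap-+ : ∀ (f g : A → ℕ) xs → sumMap (λ x → f x + g x) xs ≡ sumMap f xs + sumMap g xs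
sumMap-+ f g []       = refl
sumMap-+ f g (x ∷ xs) =
  trans (cong (f x + g x +_) (sumMap-+ f g xs)) (+-interchange (f x) (g x) _ _)

sumMap-*ˡ : ∀ c (f : A → ℕ) xs → sumMap (λ x → c * f x) xs ≡ c * sumMap f xs
sumMap-*ˡ c f []       = sym (*-zeroʳ c)
sumMap-*ˡ c f (x ∷ xs) =
  trans (cong (c * f x +_) (sumMap-*ˡ c f xs)) (sym (*-distribˡ-+ c (f x) (sumMap f xs)))

sumMap-const : ∀ c (xs : List A) → sumMap (λ _ → c) xs ≡ length xs * c
sumMap-const c []       = refl
sumMap-const c (x ∷ xs) = cong (c +_) (sumMap-const c xs)

sumMap-++ : ∀ (f : A → ℕ) xs ys → sumMap f (xs ++ ys) ≡ sumMap f xs + sumMap f ys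
sumMap-++ f xs ys = trans (cong sum (List.map-++ f xs ys)) (sum-++ (map f xs) (map f ys))

sumMap-map : ∀ (f : B → ℕ) (g : A → B) xs → sumMap f (map g xs) ≡ sumMap (f ∘ g) xs
sumMap-map f g []       = refl
sumMap-map f g (x ∷ xs) = cong (f (g x) +_) (sumMap-map f g xs)

sumMap-concatMap : ∀ (f : B → ℕ) (g : A → List B) xs →
                   sumMap f (concatMap g xs) ≡ sumMap (sumMap f ∘ g) xs
sumMap-concatMap f g []       = refl
sumMap-concatMap f g (x ∷ xs) =
  trans (sumMap-++ f (g x) (concatMap g xs)) (cong (sumMap f (g x) +_) (sumMap-concatMap f g xs))

sum-concatMap : ∀ (g : A → List ℕ) xs → sum (concatMap g xs) ≡ sumMap (sum ∘ g) xs
sum-concatMap g []       = refl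
sum-concatMap g (x ∷ xs) = trans (sum-++ (g x) (concatMap g xs)) (cong (sum (g x) +_) (sum-concatMap g xs))

sumMap-swap : ∀ (F : A → B → ℕ) xs ys →
              sumMap (λ x → sumMap (F x) ys) xs ≡ sumMap (λ y → sumMap (λ x → F x y) xs) ys
sumMap-swap F []       ys = sym (trans (sumMap-const 0 ys) (*-zeroʳ (length ys)))
sumMap-swap F (x ∷ xs) ys =
  trans (cong (sumMap (F x) ys +_) (sumMap-swap F xs ys)) (sym (sumMap-+ (F x) _ ys))

sumMap-↭ : ∀ (f : A → ℕ) {xs ys} → xs ↭ ys → sumMap f xs ≡ sumMap f ys
sumMap-↭ f xs↭ys = sum-↭ (map⁺ f xs↭ys)

sumMap-allFin-suc : ∀ (f : Fin (suc n) → ℕ) →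
                    sumMap f (allFin (suc n)) ≡ f zero + sumMap (f ∘ suc) (allFin n)
sumMap-allFin-suc {n} f = cong (λ xs → f zero + sum xs)
  (trans (List.map-tabulate suc f) (sym (List.map-tabulate (λ i → i) (f ∘ suc))))

length-allFin : ∀ n → length (allFin n) ≡ n
length-allFin n = List.length-tabulate (λ i → i)

sumMap-*-sumMap : ∀ (f : A → ℕ) (g : B → ℕ) xs ys →
                  sumMap f xs * sumMap g ys ≡ sumMap (λ x → sumMap (λ y → f x * g y) ys) xs
sumMap-*-sumMap f g xs ys = begin
  sumMap f xs * sumMap g ys              ≡⟨ *-comm (sumMap f xs) _ ⟩
  sumMap g ys * sumMap f xs              ≡⟨ sumMap-*ˡ (sumMap g ys) f xs ⟨
  sumMap (λ x → sumMap g ys * f x) xs    ≡⟨ sumMap-cong xs (λ x → *-comm (sumMap g ys) (f x)) ⟩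
  sumMap (λ x → f x * sumMap g ys) xs    ≡⟨ sumMap-cong xs (λ x → sumMap-*ˡ (f x) g ys) ⟨
  sumMap (λ x → sumMap (λ y → f x * g y) ys) xs ∎
  where open ≡-Reasoning

*-pos : ∀ {m n} → 0 < m → 0 < n → 0 < m * n
*-pos {suc _} {suc _} _ _ = s≤s z≤n

n≤n*n : ∀ n → n ≤ n * n
n≤n*n zero      = z≤n
n≤n*n n@(suc _) = m≤m*n n n

2xy≤x²+y²-≤ : ∀ {x y} → x ≤ y → 2 * (x * y) ≤ x * x + y * y
2xy≤x²+y²-≤ {x} {y} x≤y = subst (λ y → 2 * (x * y) ≤ x * x + y * y) (m+[n∸m]≡n x≤y)
  (≤-trans (m≤m+n _ _) (≤-reflexive (square x (y ∸ x))))
  where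
  square : ∀ x d → 2 * (x * (x + d)) + d * d ≡ x * x + (x + d) * (x + d)
  square = solve-∀

2xy≤x²+y² : ∀ x y → 2 * (x * y) ≤ x * x + y * y
2xy≤x²+y² x y with ≤-total x y
... | inj₁ x≤y = 2xy≤x²+y²-≤ x≤y
... | inj₂ y≤x = subst₂ _≤_ (cong (2 *_) (*-comm y x)) (+-comm (y * y) (x * x)) (2xy≤x²+y²-≤ y≤x)

[m+n]²≤2m²+2n² : ∀ m n → (m + n) * (m + n) ≤ 2 * (m * m) + 2 * (n * n)
[m+n]²≤2m²+2n² m n = begin
  (m + n) * (m + n)                ≡⟨ expand m n ⟩
  m * m + n * n + 2 * (m * n)      ≤⟨ +-monoʳ-≤ (m * m + n * n) (2xy≤x²+y² m n) ⟩
  m * m + n * n + (m * m + n * n)  ≡⟨ collect m n ⟩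
  2 * (m * m) + 2 * (n * n)        ∎
  where
  open ≤-Reasoning
  expand : ∀ m n → (m + n) * (m + n) ≡ m * m + n * n + 2 * (m * n)
  expand = solve-∀
  collect : ∀ m n → m * m + n * n + (m * m + n * n) ≡ 2 * (m * m) + 2 * (n * n)
  collect = solve-∀

-- Both sides are double sums over pairs (x, y); compare them termwise by 2 X Y ≤ X² + Y² with X = f x g y, Y = f y g x.
cauchy-schwarz : ∀ (w f g : A → ℕ) xs →
  sumMap (λ x → w x * (f x * g x)) xs * sumMap (λ x → w x * (f x * g x)) xs
    ≤ sumMap (λ x → w x * (f x * f x)) xs * sumMap (λ x → w x * (g x * g x)) xs
cauchy-schwarz {A} w f g xs = *-cancelˡ-≤ 2 (begin
  2 * (sumMap h xs * sumMap h xs)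
    ≡⟨ cong (2 *_) (sumMap-*-sumMap h h xs xs) ⟩
  2 * sumMap (λ x → sumMap (λ y → h x * h y) xs) xs
    ≡⟨ sumMap-*ˡ 2 _ xs ⟨
  sumMap (λ x → 2 * sumMap (λ y → h x * h y) xs) xs
    ≡⟨ sumMap-cong xs (λ x → sumMap-*ˡ 2 _ xs) ⟨
  sumMap (λ x → sumMap (λ y → 2 * (h x * h y)) xs) xs
    ≤⟨ sumMap-mono xs (λ x → sumMap-mono xs (λ y → pointwise x y)) ⟩
  sumMap (λ x → sumMap (λ y → p x * q y + p y * q x) xs) xs
    ≡⟨ sumMap-cong xs (λ x → sumMap-+ _ _ xs) ⟩
  sumMap (λ x → sumMap (λ y → p x * q y) xs + sumMap (λ y → p y * q x) xs) xs
    ≡⟨ sumMap-+ _ _ xs ⟩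
  PQ + sumMap (λ x → sumMap (λ y → p y * q x) xs) xs
    ≡⟨ cong (PQ +_) (sumMap-swap (λ x y → p y * q x) xs xs) ⟩
  PQ + PQ
    ≡⟨ cong (PQ +_) (+-identityʳ PQ) ⟨
  2 * PQ
    ≡⟨ cong (2 *_) (sumMap-*-sumMap p q xs xs) ⟨
  2 * (sumMap p xs * sumMap q xs) ∎)
  where
  open ≤-Reasoning
  h p q : A → ℕ
  h x = w x * (f x * g x)
  p x = w x * (f x * f x)
  q x = w x * (g x * g x)
  PQ = sumMap (λ x → sumMap (λ y → p x * q y) xs) xs
  pointwise : ∀ x y → 2 * (h x * h y) ≤ p x * q y + p y * q x
  pointwise x y = subst₂ _≤_ (lhs (w x) (w y) (f x) (f y) (g x) (g y)) (rhs (w x) (w y) (f x) (f y) (g x) (g y))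
    (*-monoʳ-≤ (w x * w y) (2xy≤x²+y² (f x * g y) (f y * g x)))
    where
    lhs : ∀ wx wy fx fy gx gy → wx * wy * (2 * ((fx * gy) * (fy * gx))) ≡ 2 * (wx * (fx * gx) * (wy * (fy * gy)))
    lhs = solve-∀
    rhs : ∀ wx wy fx fy gx gy → wx * wy * ((fx * gy) * (fx * gy) + (fy * gx) * (fy * gx))
                              ≡ wx * (fx * fx) * (wy * (gy * gy)) + wy * (fy * fy) * (wx * (gx * gx))
    rhs = solve-∀

sumMap-sq≤ : ∀ (v : A → ℕ) xs → sumMap v xs * sumMap v xs ≤ length xs * sumMap (λ x → v x * v x) xs
sumMap-sq≤ v xs = subst₂ _≤_
  (cong (λ s → s * s) (sumMap-cong xs (λ x → trans (*-identityˡ _) (*-identityˡ (v x)))))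
  (cong₂ _*_ (trans (sumMap-const 1 xs) (*-identityʳ (length xs))) (sumMap-cong xs (λ x → *-identityˡ _)))
  (cauchy-schwarz (λ _ → 1) (λ _ → 1) v xs)

m²≤ab∧b²≤mc⇒m³≤a²c : ∀ {m a b c} → m * m ≤ a * b → b * b ≤ m * c → m * m * m ≤ a * a * c
m²≤ab∧b²≤mc⇒m³≤a²c {zero}          _  _  = z≤n
m²≤ab∧b²≤mc⇒m³≤a²c {m@(suc _)} {a} {b} {c} h₁ h₂ = *-cancelˡ-≤ m (begin
  m * (m * m * m)       ≡⟨ e₁ m ⟩
  (m * m) * (m * m)     ≤⟨ *-mono-≤ h₁ h₁ ⟩
  (a * b) * (a * b)     ≡⟨ e₂ a b ⟩
  a * a * (b * b)       ≤⟨ *-monoʳ-≤ (a * a) h₂ ⟩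
  a * a * (m * c)       ≡⟨ e₃ a m c ⟩
  m * (a * a * c)       ∎)
  where
  open ≤-Reasoning
  e₁ : ∀ m → m * (m * m * m) ≡ (m * m) * (m * m)
  e₁ = solve-∀
  e₂ : ∀ a b → (a * b) * (a * b) ≡ a * a * (b * b)
  e₂ = solve-∀
  e₃ : ∀ a m c → a * a * (m * c) ≡ m * (a * a * c)
  e₃ = solve-∀

-- (E v²)³ ≤ (E v)² E v⁴ by Cauchy–Schwarz twice: (Σ v²)² ≤ Σ v · Σ v³ and (Σ v³)² ≤ Σ v² · Σ v⁴.
sumMap-holder : ∀ (v : A → ℕ) xs →
  sumMap (λ x → v x * v x) xs * sumMap (λ x → v x * v x) xs * sumMap (λ x → v x * v x) xs
    ≤ sumMap v xs * sumMap v xs * sumMap (λ x → (v x * v x) * (v x * v x)) xs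
sumMap-holder v xs = m²≤ab∧b²≤mc⇒m³≤a²c {sumMap (λ x → v x * v x) xs} {sumMap v xs} {S₃}
  (subst₂ _≤_ (cong (λ s → s * s) (sumMap-cong xs (λ x → cong (v x *_) (*-identityˡ (v x)))))
              (cong (_* S₃) (sumMap-cong xs (λ x → *-identityʳ (v x))))
              (cauchy-schwarz v (λ _ → 1) v xs))
  (subst₂ _≤_ (cong (λ s → s * s) (sumMap-cong xs (λ x → *-identityˡ _)))
              (cong₂ _*_ (sumMap-cong xs (λ x → *-identityˡ _)) (sumMap-cong xs (λ x → *-identityˡ _)))
              (cauchy-schwarz (λ _ → 1) v (λ x → v x * v x) xs))
  where
  S₃ = sumMap (λ x → v x * (v x * v x)) xs

dist-refl : ∀ (x : Fin b) → dist x x ≡ 0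
dist-refl x with x ≟ x
... | yes _  = refl
... | no x≢x = ⊥-elim (x≢x refl)

dist-≢ : ∀ {x y : Fin b} → x ≢ y → dist x y ≡ 2
dist-≢ {x = x} {y} x≢y with x ≟ y
... | yes x≡y = ⊥-elim (x≢y x≡y)
... | no _    = refl

dist≤2 : ∀ (x y : Fin b) → dist x y ≤ 2
dist≤2 x y with x ≟ y
... | yes _ = z≤n
... | no _  = ≤-refl

dist-sym : ∀ (x y : Fin b) → dist x y ≡ dist y x
dist-sym x y with x ≟ y
... | yes refl = sym (dist-refl x)
... | no x≢y   = sym (dist-≢ (x≢y ∘ sym))

dist-triangle : ∀ (x y z : Fin b) → dist x z ≤ dist x y + dist y z
dist-triangle x y z = by-cases (x ≟ y) (y ≟ z)
  where
  by-cases : Dec (x ≡ y) → Dec (y ≡ z) → dist x z ≤ dist x y + dist y z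
  by-cases (yes refl) _          = m≤n+m (dist x z) (dist x x)
  by-cases (no _)     (yes refl) = m≤m+n (dist x y) (dist y y)
  by-cases (no x≢y)   (no _)     =
    subst (λ d → dist x z ≤ d + dist y z) (sym (dist-≢ x≢y)) (≤-trans (dist≤2 x z) (m≤m+n 2 _))

δ : Fin b → Fin b → ℕ
δ z x with x ≟ z
... | yes _ = 1
... | no  _ = 0

mult : Fin b → List (Fin b) → ℕ
mult z = sumMap (δ z)

δ-refl : ∀ (z : Fin b) → δ z z ≡ 1
δ-refl z with z ≟ z
... | yes _  = refl
... | no z≢z = ⊥-elim (z≢z refl)

δ-≢ : ∀ {z x : Fin b} → x ≢ z → δ z x ≡ 0
δ-≢ {z = z} {x} x≢z with x ≟ z
... | yes x≡z = ⊥-elim (x≢z x≡z)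
... | no _    = refl

δ≤1 : ∀ (z x : Fin b) → δ z x ≤ 1
δ≤1 z x with x ≟ z
... | yes _ = ≤-refl
... | no _  = z≤n

δ-suc : ∀ (z x : Fin b) → δ (suc z) (suc x) ≡ δ z x
δ-suc z x = by-cases (x ≟ z)
  where
  by-cases : Dec (x ≡ z) → δ (suc z) (suc x) ≡ δ z x
  by-cases (yes refl) = trans (δ-refl (suc z)) (sym (δ-refl z))
  by-cases (no x≢z)   = trans (δ-≢ (x≢z ∘ Data.Fin.Properties.suc-injective)) (sym (δ-≢ x≢z))

2δ-lipschitz : ∀ (z x y : Fin b) → 2 * δ z x ≤ dist x y + 2 * δ z y
2δ-lipschitz z x y = by-cases (x ≟ y)
  where
  by-cases : Dec (x ≡ y) → 2 * δ z x ≤ dist x y + 2 * δ z y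
  by-cases (yes refl) = m≤n+m (2 * δ z x) (dist x x)
  by-cases (no x≢y)   = ≤-trans (*-monoʳ-≤ 2 (δ≤1 z x))
                          (subst (λ d → 2 ≤ d + 2 * δ z y) (sym (dist-≢ x≢y)) (m≤m+n 2 _))

sumMap-*δ : ∀ (f : Fin b → ℕ) (z : Fin b) → sumMap (λ i → f i * δ z i) (allFin b) ≡ f z
sumMap-*δ {suc b} f zero = begin
  sumMap (λ i → f i * δ zero i) (allFin (suc b))
    ≡⟨ trans (sumMap-allFin-suc {b} (λ i → f i * δ zero i))
             (cong₂ _+_ (cong (f zero *_) (δ-refl {suc b} zero))
                        (sumMap-cong (allFin b) (λ i → cong (f (suc i) *_) (δ-≢ {z = zero} {suc i} λ ())))) ⟩
  f zero * 1 + sumMap (λ i → f (suc i) * 0) (allFin b)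
    ≡⟨ cong₂ _+_ (*-identityʳ (f zero)) (sumMap-cong (allFin b) (λ i → *-zeroʳ (f (suc i)))) ⟩
  f zero + sumMap (λ _ → 0) (allFin b)
    ≡⟨ cong (f zero +_) (trans (sumMap-const 0 (allFin b)) (*-zeroʳ (length (allFin b)))) ⟩
  f zero + 0
    ≡⟨ +-identityʳ (f zero) ⟩
  f zero ∎
  where open ≡-Reasoning
sumMap-*δ {suc b} f (suc z) = begin
  sumMap (λ i → f i * δ (suc z) i) (allFin (suc b))
    ≡⟨ sumMap-allFin-suc {b} (λ i → f i * δ (suc z) i) ⟩
  f zero * δ (suc z) zero + sumMap (λ i → f (suc i) * δ (suc z) (suc i)) (allFin b)
    ≡⟨ cong₂ _+_ (trans (cong (f zero *_) (δ-≢ {z = suc z} {zero} λ ())) (*-zeroʳ (f zero)))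
                 (sumMap-cong (allFin b) (λ i → cong (f (suc i) *_) (δ-suc z i))) ⟩
  sumMap (λ i → f (suc i) * δ z i) (allFin b)
    ≡⟨ sumMap-*δ (f ∘ suc) z ⟩
  f (suc z) ∎
  where open ≡-Reasoning

sumMap-∘δ : ∀ {u} (ψ : ℕ → ℕ) (z : Fin (suc u)) → sumMap (λ i → ψ (δ z i)) (allFin (suc u)) ≡ ψ 1 + u * ψ 0
sumMap-∘δ {u} ψ zero = begin
  sumMap (λ i → ψ (δ zero i)) (allFin (suc u))
    ≡⟨ trans (sumMap-allFin-suc {u} (λ i → ψ (δ zero i)))
             (cong₂ _+_ (cong ψ (δ-refl {suc u} zero))
                        (sumMap-cong (allFin u) (λ i → cong ψ (δ-≢ {z = zero} {suc i} λ ())))) ⟩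
  ψ 1 + sumMap (λ _ → ψ 0) (allFin u)
    ≡⟨ cong (ψ 1 +_) (trans (sumMap-const (ψ 0) (allFin u)) (cong (_* ψ 0) (length-allFin u))) ⟩
  ψ 1 + u * ψ 0 ∎
  where open ≡-Reasoning
sumMap-∘δ {suc u} ψ (suc z) = begin
  sumMap (λ i → ψ (δ (suc z) i)) (allFin (suc (suc u)))
    ≡⟨ sumMap-allFin-suc {suc u} (λ i → ψ (δ (suc z) i)) ⟩
  ψ (δ (suc z) zero) + sumMap (λ i → ψ (δ (suc z) (suc i))) (allFin (suc u))
    ≡⟨ cong₂ _+_ (cong ψ (δ-≢ {z = suc z} {zero} λ ())) (sumMap-cong (allFin (suc u)) (λ i → cong ψ (δ-suc z i))) ⟩
  ψ 0 + sumMap (λ i → ψ (δ z i)) (allFin (suc u))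
    ≡⟨ cong (ψ 0 +_) (sumMap-∘δ ψ z) ⟩
  ψ 0 + (ψ 1 + u * ψ 0)
    ≡⟨ m+[n+o]≡n+[m+o] (ψ 0) (ψ 1) (u * ψ 0) ⟩
  ψ 1 + suc u * ψ 0 ∎
  where open ≡-Reasoning

m≤o+n∧n≤o+m⇒∣m-n∣≤o : ∀ {m n o} → m ≤ o + n → n ≤ o + m → ∣ m - n ∣ ≤ o
m≤o+n∧n≤o+m⇒∣m-n∣≤o {m} {n} {o} m≤o+n n≤o+m with ≤-total m n
... | inj₁ m≤n = subst (_≤ o) (sym (m≤n⇒∣m-n∣≡n∸m m≤n)) (m≤n+o⇒m∸n≤o n m (subst (n ≤_) (+-comm o m) n≤o+m))
... | inj₂ n≤m = subst (_≤ o) (sym (m≤n⇒∣n-m∣≡n∸m n≤m)) (m≤n+o⇒m∸n≤o m n (subst (m ≤_) (+-comm o n) m≤o+n))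

-- The edges that cycleGo traverses along r₀ x₀ r₁ x₁ … rₖ xₖ f, each stored as a (red , blue) pair.
cycleEdges : List (Fin b) → List (Fin b) → Fin b → List (Fin b × Fin b)
cycleEdges (r ∷ r′ ∷ rs) (x ∷ xs) f = (r , x) ∷ (r′ , x) ∷ cycleEdges (r′ ∷ rs) xs f
cycleEdges (r ∷ [])      (x ∷ _)  f = (r , x) ∷ (f , x) ∷ []
cycleEdges _             _        _ = []

cycleGo≡sumMap-cycleEdges : ∀ (rs xs : List (Fin b)) f → cycleGo rs xs f ≡ sumMap (uncurry dist) (cycleEdges rs xs f)
cycleGo≡sumMap-cycleEdges []            _        f = refl
cycleGo≡sumMap-cycleEdges (r ∷ [])      []       f = refl
cycleGo≡sumMap-cycleEdges (r ∷ [])      (x ∷ _)  f = cong (dist r x +_) (trans (dist-sym x f) (sym (+-identityʳ _)))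
cycleGo≡sumMap-cycleEdges (r ∷ r′ ∷ rs) []       f = refl
cycleGo≡sumMap-cycleEdges (r ∷ r′ ∷ rs) (x ∷ xs) f =
  trans (+-assoc (dist r x) _ _)
        (cong (dist r x +_) (cong₂ _+_ (dist-sym x r′) (cycleGo≡sumMap-cycleEdges (r′ ∷ rs) xs f)))

sumMap-red-cycleEdges : ∀ (w : Fin b → ℕ) r rs xs f → length xs ≡ suc (length rs) →
  sumMap (w ∘ proj₁) (cycleEdges (r ∷ rs) xs f) ≡ w r + 2 * sumMap w rs + w f
sumMap-red-cycleEdges w r []        (x ∷ [])     f _   = ends (w r) (w f)
  where
  ends : ∀ a c → a + (c + 0) ≡ a + 2 * 0 + c
  ends = solve-∀
sumMap-red-cycleEdges w r []        (x ∷ y ∷ xs) f ()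
sumMap-red-cycleEdges w r (r′ ∷ rs) (x ∷ xs)     f len =
  trans (cong (λ s → w r + (w r′ + s)) (sumMap-red-cycleEdges w r′ rs xs f (suc-injective len)))
        (middle (w r) (w r′) (sumMap w rs) (w f))
  where
  middle : ∀ a a′ s c → a + (a′ + (a′ + 2 * s + c)) ≡ a + 2 * (a′ + s) + c
  middle = solve-∀

sumMap-blue-cycleEdges : ∀ (v : Fin b → ℕ) r rs xs f → length xs ≡ suc (length rs) →
  sumMap (v ∘ proj₂) (cycleEdges (r ∷ rs) xs f) ≡ 2 * sumMap v xs
sumMap-blue-cycleEdges v r []        (x ∷ [])     f _   = twice (v x)
  where
  twice : ∀ a → a + (a + 0) ≡ 2 * (a + 0)
  twice = solve-∀
sumMap-blue-cycleEdges v r []        (x ∷ y ∷ xs) f ()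
sumMap-blue-cycleEdges v r (r′ ∷ rs) (x ∷ xs)     f len =
  trans (cong (λ s → v x + (v x + s)) (sumMap-blue-cycleEdges v r′ rs xs f (suc-injective len)))
        (twice (v x) (sumMap v xs))
  where
  twice : ∀ a s → a + (a + 2 * s) ≡ 2 * (a + s)
  twice = solve-∀

-- Every point lies on two edges of the tour, and along an edge w changes by at most the edge length.
cycleCost-lipschitz : ∀ (w : Fin b → ℕ) → (∀ x y → w x ≤ dist x y + w y) →
  ∀ rs xs → length xs ≡ length rs → 2 * ∣ sumMap w rs - sumMap w xs ∣ ≤ cycleCost rs xs
cycleCost-lipschitz w lip []       []      _   = z≤n
cycleCost-lipschitz {b} w lip (r ∷ rs) xs len =
  subst (_≤ cycleCost (r ∷ rs) xs) (sym (*-distribˡ-∣-∣ 2 (sumMap w (r ∷ rs)) (sumMap w xs)))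
    (m≤o+n∧n≤o+m⇒∣m-n∣≤o
      (subst₂ _≤_ reds (cong₂ _+_ (sym cost) blues) (edgewise (w ∘ proj₁) (w ∘ proj₂) λ (r , x) → lip r x))
      (subst₂ _≤_ blues (cong₂ _+_ (sym cost) reds) (edgewise (w ∘ proj₂) (w ∘ proj₁) λ (r , x) →
        subst (λ d → w x ≤ d + w r) (dist-sym x r) (lip x r))))
  where
  E = cycleEdges (r ∷ rs) xs r
  cost : cycleCost (r ∷ rs) xs ≡ sumMap (uncurry dist) E
  cost = cycleGo≡sumMap-cycleEdges (r ∷ rs) xs r
  reds : sumMap (w ∘ proj₁) E ≡ 2 * sumMap w (r ∷ rs)
  reds = trans (sumMap-red-cycleEdges w r rs xs r len) (closing (w r) (sumMap w rs))
    where
    closing : ∀ a s → a + 2 * s + a ≡ 2 * (a + s)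
    closing = solve-∀
  blues : sumMap (w ∘ proj₂) E ≡ 2 * sumMap w xs
  blues = sumMap-blue-cycleEdges w r rs xs r len
  edgewise : ∀ (g h : Fin b × Fin b → ℕ) → (∀ e → g e ≤ uncurry dist e + h e) →
             sumMap g E ≤ sumMap (uncurry dist) E + sumMap h E
  edgewise g h g≤ = ≤-trans (sumMap-mono E g≤) (≤-reflexive (sumMap-+ (uncurry dist) h E))

∈-insertions⇒↭ : ∀ {x : A} xs {ys} → ys ∈ insertions x xs → ys ↭ x ∷ xs
∈-insertions⇒↭ []       (here refl) = ↭-refl
∈-insertions⇒↭ (y ∷ xs) (here refl) = ↭-refl
∈-insertions⇒↭ {x = x} (y ∷ xs) (there ys∈) with ∈-map⁻ (y ∷_) ys∈
... | zs , zs∈ , refl = ↭-trans (↭-prep y (∈-insertions⇒↭ xs zs∈)) (↭-swap y x ↭-refl)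

∈-perms⇒↭ : ∀ (xs : List A) {ys} → ys ∈ perms xs → ys ↭ xs
∈-perms⇒↭ []       (here refl) = ↭-refl
∈-perms⇒↭ (x ∷ xs) ys∈ with find (∈-concatMap⁻ (insertions x) {xs = perms xs} ys∈)
... | zs , zs∈ , ys∈′ = ↭-trans (∈-insertions⇒↭ zs ys∈′) (↭-prep x (∈-perms⇒↭ xs zs∈))

++-∈-insertions : ∀ (x : A) as cs → as ++ x ∷ cs ∈ insertions x (as ++ cs)
++-∈-insertions x []       []       = here refl
++-∈-insertions x []       (c ∷ cs) = here refl
++-∈-insertions x (a ∷ as) cs       = there (∈-map⁺ (a ∷_) (++-∈-insertions x as cs))

mult>0⇒∈ : ∀ (z : Fin b) xs → 0 < mult z xs → z ∈ xs
mult>0⇒∈ z (x ∷ xs) 0<m with x ≟ z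
... | yes refl = here refl
... | no _     = there (mult>0⇒∈ z xs 0<m)

mult-++ : ∀ (z : Fin b) xs ys → mult z (xs ++ ys) ≡ mult z xs + mult z ys
mult-++ z = sumMap-++ (δ z)

mult-≗⇒∈-perms : ∀ (xs ys : List (Fin b)) → (∀ z → mult z ys ≡ mult z xs) → ys ∈ perms xs
mult-≗⇒∈-perms []       []       _    = here refl
mult-≗⇒∈-perms []       (y ∷ ys) same = ⊥-elim (1+n≢0 (trans (cong (_+ mult y ys) (sym (δ-refl y))) (same y)))
mult-≗⇒∈-perms (x ∷ xs) ys       same
  with as , cs , refl ← ∈-∃++ (mult>0⇒∈ x ys (subst (0 <_) (sym (same x))
                                   (subst (λ d → 0 < d + mult x xs) (sym (δ-refl x)) (s≤s z≤n))))
  = ∈-concatMap⁺ (insertions x) {xs = perms xs}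
      (lose (mult-≗⇒∈-perms xs (as ++ cs) same′) (++-∈-insertions x as cs))
  where
  same′ : ∀ z → mult z (as ++ cs) ≡ mult z xs
  same′ z = +-cancelˡ-≡ (δ z x) _ _ (begin
    δ z x + mult z (as ++ cs)         ≡⟨ cong (δ z x +_) (mult-++ z as cs) ⟩
    δ z x + (mult z as + mult z cs)   ≡⟨ m+[n+o]≡n+[m+o] (δ z x) (mult z as) (mult z cs) ⟩
    mult z as + (δ z x + mult z cs)   ≡⟨ mult-++ z as (x ∷ cs) ⟨
    mult z (as ++ x ∷ cs)             ≡⟨ same z ⟩
    mult z (x ∷ xs)                   ∎)
    where open ≡-Reasoning

foldr-⊓≤ : ∀ y ys {x} → x ∈ y ∷ ys → foldr _⊓_ y ys ≤ x
foldr-⊓≤ y []       (here refl)         = ≤-refl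
foldr-⊓≤ y (w ∷ ws) (here refl)         = ≤-trans (m⊓n≤n w _) (foldr-⊓≤ y ws (here refl))
foldr-⊓≤ y (w ∷ ws) (there (here refl)) = m⊓n≤m w _
foldr-⊓≤ y (w ∷ ws) (there (there x∈))  = ≤-trans (m⊓n≤n w _) (foldr-⊓≤ y ws (there x∈))

foldr-⊓-glb : ∀ {k} y ys → (∀ {x} → x ∈ y ∷ ys → k ≤ x) → k ≤ foldr _⊓_ y ys
foldr-⊓-glb y []       k≤ = k≤ (here refl)
foldr-⊓-glb y (w ∷ ws) k≤ = ⊓-glb (k≤ (there (here refl))) (foldr-⊓-glb y ws λ where
  (here refl) → k≤ (here refl)
  (there x∈)  → k≤ (there (there x∈)))

minList≤ : ∀ {x} xs → x ∈ xs → minList xs ≤ x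
minList≤ (y ∷ ys) = foldr-⊓≤ y ys

minList-glb : ∀ {k x} xs → x ∈ xs → (∀ {y} → y ∈ xs → k ≤ y) → k ≤ minList xs
minList-glb (y ∷ ys) _ = foldr-⊓-glb y ys

∈-perms-self : ∀ (xs : List (Fin b)) → xs ∈ perms xs
∈-perms-self xs = mult-≗⇒∈-perms xs xs (λ _ → refl)

module _ (R B : Vec (Fin b) n) where

  private
    tourCosts : List ℕ
    tourCosts = concatMap (λ rs → map (cycleCost rs) (perms (toList B))) (perms (toList R))

    ∈-tourCosts : ∀ {rs bs} → rs ∈ perms (toList R) → bs ∈ perms (toList B) → cycleCost rs bs ∈ tourCosts
    ∈-tourCosts {rs} rs∈ bs∈ = ∈-concatMap⁺ _ {xs = perms (toList R)} (lose rs∈ (∈-map⁺ (cycleCost rs) bs∈))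

  optTour≤ : ∀ {rs bs} → rs ∈ perms (toList R) → bs ∈ perms (toList B) → optTour R B ≤ cycleCost rs bs
  optTour≤ rs∈ bs∈ = minList≤ tourCosts (∈-tourCosts rs∈ bs∈)

  optTour-glb : ∀ {k} → (∀ {rs bs} → rs ∈ perms (toList R) → bs ∈ perms (toList B) → k ≤ cycleCost rs bs) →
                k ≤ optTour R B
  optTour-glb k≤ = minList-glb tourCosts (∈-tourCosts (∈-perms-self (toList R)) (∈-perms-self (toList B))) λ c∈ →
    let rs , rs∈ , c∈′ = find (∈-concatMap⁻ _ {xs = perms (toList R)} c∈)
        bs , bs∈ , c≡  = ∈-map⁻ (cycleCost rs) c∈′
    in subst (_ ≤_) (sym c≡) (k≤ rs∈ bs∈)

optTour-≥-mult : ∀ (z : Fin b) (R B : Vec (Fin b) n) → 4 * ∣ mult z (toList R) - mult z (toList B) ∣ ≤ optTour R B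
optTour-≥-mult z R B = optTour-glb R B λ {rs} {bs} rs∈ bs∈ →
  let rs↭R = ∈-perms⇒↭ (toList R) rs∈
      bs↭B = ∈-perms⇒↭ (toList B) bs∈
  in subst₂ (λ p q → 4 * ∣ p - q ∣ ≤ cycleCost rs bs) (sumMap-↭ (δ z) rs↭R) (sumMap-↭ (δ z) bs↭B)
       (4∣Δmult∣≤cycleCost rs bs (trans (↭-length bs↭B) (trans (length-toList B)
                                   (sym (trans (↭-length rs↭R) (length-toList R))))))
  where
  4∣Δmult∣≤cycleCost : ∀ rs bs → length bs ≡ length rs → 4 * ∣ mult z rs - mult z bs ∣ ≤ cycleCost rs bs
  4∣Δmult∣≤cycleCost rs bs len = subst (_≤ cycleCost rs bs)
    (trans (cong (2 *_) (trans (cong₂ ∣_-_∣ (sumMap-*ˡ 2 (δ z) rs) (sumMap-*ˡ 2 (δ z) bs))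
                               (sym (*-distribˡ-∣-∣ 2 (mult z rs) (mult z bs)))))
           (sym (*-assoc 2 2 ∣ mult z rs - mult z bs ∣)))
    (cycleCost-lipschitz (λ x → 2 * δ z x) (2δ-lipschitz z) rs bs len)

-- An explicit tour: first the common points, then the excess

pathCost : List (Fin b) → ℕ
pathCost (x ∷ y ∷ xs) = dist x y + pathCost (y ∷ xs)
pathCost _            = 0

matchCost : List (Fin b) → List (Fin b) → ℕ
matchCost (x ∷ xs) (y ∷ ys) = dist x y + matchCost xs ys
matchCost _        _        = 0

-- Each return edge from a blue point to the next red one is bounded by the triangle inequality.
cycleGo≤ : ∀ (r : Fin b) rs xs f → cycleGo (r ∷ rs) xs f ≤ 2 * matchCost (r ∷ rs) xs + pathCost (r ∷ rs) + 2
cycleGo≤ r []        []       f = z≤n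
cycleGo≤ r (r′ ∷ rs) []       f = z≤n
cycleGo≤ r []        (x ∷ xs) f = begin
  dist r x + dist x f             ≤⟨ +-monoʳ-≤ (dist r x) (dist≤2 x f) ⟩
  dist r x + 2                    ≤⟨ +-monoˡ-≤ 2 (m≤m+n (dist r x) (dist r x)) ⟩
  dist r x + dist r x + 2         ≡⟨ twice (dist r x) ⟩
  2 * (dist r x + 0) + 0 + 2      ∎
  where
  open ≤-Reasoning
  twice : ∀ d → d + d + 2 ≡ 2 * (d + 0) + 0 + 2
  twice = solve-∀
cycleGo≤ r (r′ ∷ rs) (x ∷ xs) f = begin
  dist r x + dist x r′ + cycleGo (r′ ∷ rs) xs f
    ≤⟨ +-mono-≤ (+-monoʳ-≤ (dist r x) (subst (λ d → dist x r′ ≤ d + dist r r′) (dist-sym x r) (dist-triangle x r r′)))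
                (cycleGo≤ r′ rs xs f) ⟩
  dist r x + (dist r x + dist r r′) + (2 * M + P + 2)
    ≡⟨ regroup (dist r x) (dist r r′) M P ⟩
  2 * (dist r x + M) + (dist r r′ + P) + 2 ∎
  where
  open ≤-Reasoning
  M = matchCost (r′ ∷ rs) xs
  P = pathCost (r′ ∷ rs)
  regroup : ∀ d d′ M P → d + (d + d′) + (2 * M + P + 2) ≡ 2 * (d + M) + (d′ + P) + 2
  regroup = solve-∀

cycleCost≤ : ∀ (rs xs : List (Fin b)) → cycleCost rs xs ≤ 2 * matchCost rs xs + pathCost rs + 2
cycleCost≤ []       xs = z≤n
cycleCost≤ (r ∷ rs) xs = cycleGo≤ r rs xs r

matchCost-++ : ∀ (as cs ds : List (Fin b)) → matchCost (as ++ cs) (as ++ ds) ≡ matchCost cs ds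
matchCost-++ []       cs ds = refl
matchCost-++ (a ∷ as) cs ds = cong₂ _+_ (dist-refl a) (matchCost-++ as cs ds)

matchCost≤ : ∀ (xs ys : List (Fin b)) → matchCost xs ys ≤ 2 * length xs
matchCost≤ []       ys       = z≤n
matchCost≤ (x ∷ xs) []       = z≤n
matchCost≤ (x ∷ xs) (y ∷ ys) =
  subst (matchCost (x ∷ xs) (y ∷ ys) ≤_) (sym (*-distribˡ-+ 2 1 (length xs)))
        (+-mono-≤ (dist≤2 x y) (matchCost≤ xs ys))

pathCost-++ : ∀ (xs ys : List (Fin b)) → pathCost (xs ++ ys) ≤ pathCost xs + 2 + pathCost ys
pathCost-++ []           ys       = m≤n+m (pathCost ys) 2
pathCost-++ (x ∷ [])     []       = z≤n
pathCost-++ (x ∷ [])     (y ∷ ys) = +-monoˡ-≤ (pathCost (y ∷ ys)) (dist≤2 x y)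
pathCost-++ (x ∷ y ∷ xs) ys       =
  subst (dist x y + pathCost (y ∷ xs ++ ys) ≤_) (assoc₃ (dist x y) (pathCost (y ∷ xs)) (pathCost ys))
        (+-monoʳ-≤ (dist x y) (pathCost-++ (y ∷ xs) ys))
  where
  assoc₃ : ∀ a p q → a + (p + 2 + q) ≡ a + p + 2 + q
  assoc₃ = solve-∀

pathCost-replicate : ∀ k (i : Fin b) → pathCost (replicate k i) ≡ 0
pathCost-replicate zero          i = refl
pathCost-replicate (suc zero)    i = refl
pathCost-replicate (suc (suc k)) i = cong₂ _+_ (dist-refl i) (pathCost-replicate (suc k) i)

blocks : (Fin b → ℕ) → List (Fin b) → List (Fin b)
blocks f = concatMap (λ i → replicate (f i) i)

mult-replicate : ∀ (z : Fin b) k i → mult z (replicate k i) ≡ k * δ z i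
mult-replicate z zero    i = refl
mult-replicate z (suc k) i = cong (δ z i +_) (mult-replicate z k i)

mult-blocks : ∀ (z : Fin b) f → mult z (blocks f (allFin b)) ≡ f z
mult-blocks {b} z f = begin
  mult z (blocks f (allFin b))
    ≡⟨ sumMap-concatMap (δ z) (λ i → replicate (f i) i) (allFin b) ⟩
  sumMap (λ i → mult z (replicate (f i) i)) (allFin b)
    ≡⟨ sumMap-cong (allFin b) (λ i → mult-replicate z (f i) i) ⟩
  sumMap (λ i → f i * δ z i) (allFin b)
    ≡⟨ sumMap-*δ f z ⟩
  f z ∎
  where open ≡-Reasoning

length-blocks : ∀ (f : Fin b → ℕ) l → length (blocks f l) ≡ sumMap f l
length-blocks f []      = refl
length-blocks f (i ∷ l) =
  trans (List.length-++ (replicate (f i) i)) (cong₂ _+_ (List.length-replicate (f i)) (length-blocks f l))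

pathCost-blocks : ∀ (f : Fin b → ℕ) l → pathCost (blocks f l) ≤ 2 * length l
pathCost-blocks f []      = z≤n
pathCost-blocks f (i ∷ l) = begin
  pathCost (replicate (f i) i ++ blocks f l)
    ≤⟨ pathCost-++ (replicate (f i) i) (blocks f l) ⟩
  pathCost (replicate (f i) i) + 2 + pathCost (blocks f l)
    ≡⟨ cong (λ p → p + 2 + pathCost (blocks f l)) (pathCost-replicate (f i) i) ⟩
  2 + pathCost (blocks f l)
    ≤⟨ +-monoʳ-≤ 2 (pathCost-blocks f l) ⟩
  2 + 2 * length l
    ≡⟨ *-distribˡ-+ 2 1 (length l) ⟨
  2 * length (i ∷ l) ∎
  where open ≤-Reasoning

module _ (R B : Vec (Fin b) n) where

  private
    reds blues : Fin b → ℕ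
    reds  i = mult i (toList R)
    blues i = mult i (toList B)
    common     = blocks (λ i → reds i ⊓ blues i) (allFin b)
    redExcess  = blocks (λ i → reds i ∸ blues i) (allFin b)
    blueExcess = blocks (λ i → blues i ∸ reds i) (allFin b)

    reds∈ : common ++ redExcess ∈ perms (toList R)
    reds∈ = mult-≗⇒∈-perms (toList R) _ λ z → begin
      mult z (common ++ redExcess)             ≡⟨ mult-++ z common redExcess ⟩
      mult z common + mult z redExcess         ≡⟨ cong₂ _+_ (mult-blocks z _) (mult-blocks z _) ⟩
      reds z ⊓ blues z + (reds z ∸ blues z)    ≡⟨ cong (_+ (reds z ∸ blues z)) (⊓-comm (reds z) (blues z)) ⟩
      blues z ⊓ reds z + (reds z ∸ blues z)    ≡⟨ m⊓n+n∸m≡n (blues z) (reds z) ⟩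
      reds z                                   ∎
      where open ≡-Reasoning

    blues∈ : common ++ blueExcess ∈ perms (toList B)
    blues∈ = mult-≗⇒∈-perms (toList B) _ λ z → begin
      mult z (common ++ blueExcess)            ≡⟨ mult-++ z common blueExcess ⟩
      mult z common + mult z blueExcess        ≡⟨ cong₂ _+_ (mult-blocks z _) (mult-blocks z _) ⟩
      reds z ⊓ blues z + (blues z ∸ reds z)    ≡⟨ m⊓n+n∸m≡n (reds z) (blues z) ⟩
      blues z                                  ∎
      where open ≡-Reasoning

    imbalance = sumMap (λ i → ∣ reds i - blues i ∣) (allFin b)

    matchCost≤imbalance : matchCost (common ++ redExcess) (common ++ blueExcess) ≤ 2 * imbalance
    matchCost≤imbalance = begin
      matchCost (common ++ redExcess) (common ++ blueExcess) ≡⟨ matchCost-++ common redExcess blueExcess ⟩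
      matchCost redExcess blueExcess                         ≤⟨ matchCost≤ redExcess blueExcess ⟩
      2 * length redExcess                                   ≡⟨ cong (2 *_) (length-blocks _ (allFin b)) ⟩
      2 * sumMap (λ i → reds i ∸ blues i) (allFin b)
        ≤⟨ *-monoʳ-≤ 2 (sumMap-mono (allFin b) (λ i → m∸n≤∣m-n∣ (reds i) (blues i))) ⟩
      2 * imbalance                                          ∎
      where open ≤-Reasoning

    pathCost≤ : pathCost (common ++ redExcess) ≤ 2 * b + 2 + 2 * b
    pathCost≤ = begin
      pathCost (common ++ redExcess)                   ≤⟨ pathCost-++ common redExcess ⟩
      pathCost common + 2 + pathCost redExcess
        ≤⟨ +-mono-≤ (+-monoˡ-≤ 2 (pathCost-blocks _ (allFin b))) (pathCost-blocks _ (allFin b)) ⟩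
      2 * length (allFin b) + 2 + 2 * length (allFin b) ≡⟨ cong (λ l → 2 * l + 2 + 2 * l) (length-allFin b) ⟩
      2 * b + 2 + 2 * b                                ∎
      where open ≤-Reasoning

  optTour≤imbalance : optTour R B ≤ 4 * sumMap (λ i → ∣ mult i (toList R) - mult i (toList B) ∣) (allFin b) + 4 * b + 4
  optTour≤imbalance = begin
    optTour R B
      ≤⟨ optTour≤ R B reds∈ blues∈ ⟩
    cycleCost (common ++ redExcess) (common ++ blueExcess)
      ≤⟨ cycleCost≤ (common ++ redExcess) (common ++ blueExcess) ⟩
    2 * matchCost (common ++ redExcess) (common ++ blueExcess) + pathCost (common ++ redExcess) + 2
      ≤⟨ +-monoˡ-≤ 2 (+-mono-≤ (*-monoʳ-≤ 2 matchCost≤imbalance) pathCost≤) ⟩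
    2 * (2 * imbalance) + (2 * b + 2 + 2 * b) + 2
      ≡⟨ collect imbalance b ⟩
    4 * imbalance + 4 * b + 4 ∎
    where
    open ≤-Reasoning
    collect : ∀ I b → 2 * (2 * I) + (2 * b + 2 + 2 * b) + 2 ≡ 4 * I + 4 * b + 4
    collect = solve-∀

samplePairs : (b n : ℕ) → List (Vec (Fin b) n × Vec (Fin b) n)
samplePairs b n = concatMap (λ R → map (R ,_) (allVecs b n)) (allVecs b n)

sumMap-samplePairs : ∀ (F : Vec (Fin b) n × Vec (Fin b) n → ℕ) →
  sumMap F (samplePairs b n) ≡ sumMap (λ R → sumMap (λ B → F (R , B)) (allVecs b n)) (allVecs b n)
sumMap-samplePairs {b} {n} F = trans (sumMap-concatMap F (λ R → map (R ,_) (allVecs b n)) (allVecs b n))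
  (sumMap-cong (allVecs b n) (λ R → sumMap-map F (R ,_) (allVecs b n)))

totalCost≡sumMap-optTour : ∀ b n → totalCost b n ≡ sumMap (uncurry optTour) (samplePairs b n)
totalCost≡sumMap-optTour b n =
  trans (sum-concatMap (λ R → map (optTour R) (allVecs b n)) (allVecs b n))
        (sym (sumMap-samplePairs {b} {n} (uncurry optTour)))

sumMap-allVecs-suc : ∀ (f : Vec (Fin b) (suc n) → ℕ) →
  sumMap f (allVecs b (suc n)) ≡ sumMap (λ v → sumMap (λ i → f (i Vec.∷ v)) (allFin b)) (allVecs b n)
sumMap-allVecs-suc {b} {n} f = trans (sumMap-concatMap f (λ v → map (Vec._∷ v) (allFin b)) (allVecs b n))
  (sumMap-cong (allVecs b n) (λ v → sumMap-map f (Vec._∷ v) (allFin b)))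

sumMap-samplePairs-suc : ∀ (F : Vec (Fin b) (suc n) × Vec (Fin b) (suc n) → ℕ) →
  sumMap F (samplePairs b (suc n)) ≡
  sumMap (λ (R , B) → sumMap (λ i → sumMap (λ j → F (i Vec.∷ R , j Vec.∷ B)) (allFin b)) (allFin b))
         (samplePairs b n)
sumMap-samplePairs-suc {b} {n} F = begin
  sumMap F (samplePairs b (suc n))
    ≡⟨ sumMap-samplePairs F ⟩
  sumMap (λ R′ → sumMap (λ B′ → F (R′ , B′)) (allVecs b (suc n))) (allVecs b (suc n))
    ≡⟨ sumMap-cong (allVecs b (suc n)) (λ R′ → sumMap-allVecs-suc (λ B′ → F (R′ , B′))) ⟩
  sumMap (λ R′ → sumMap (λ B → sumMap (λ j → F (R′ , j Vec.∷ B)) (allFin b)) (allVecs b n)) (allVecs b (suc n))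
    ≡⟨ sumMap-allVecs-suc {b} {n} _ ⟩
  sumMap (λ R → sumMap (λ i → sumMap (λ B → sumMap (λ j → F (i Vec.∷ R , j Vec.∷ B)) (allFin b)) (allVecs b n))
                       (allFin b)) (allVecs b n)
    ≡⟨ sumMap-cong (allVecs b n) (λ R → sumMap-swap _ (allFin b) (allVecs b n)) ⟩
  sumMap (λ R → sumMap (λ B → sumMap (λ i → sumMap (λ j → F (i Vec.∷ R , j Vec.∷ B)) (allFin b)) (allFin b))
                       (allVecs b n)) (allVecs b n)
    ≡⟨ sumMap-samplePairs {b} {n} _ ⟨
  sumMap (λ (R , B) → sumMap (λ i → sumMap (λ j → F (i Vec.∷ R , j Vec.∷ B)) (allFin b)) (allFin b))
         (samplePairs b n) ∎
  where open ≡-Reasoning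

-- Moments of the imbalance at one leaf

-- With d = |D| for an integer D, neighbours φ d = φ |D + 1| + φ |D - 1|.
neighbours : (ℕ → ℕ) → ℕ → ℕ
neighbours φ zero    = φ 1 + φ 1
neighbours φ (suc d) = φ (suc (suc d)) + φ d

∣-∣-neighbours : ∀ φ r s → φ ∣ suc r - s ∣ + φ ∣ r - suc s ∣ ≡ neighbours φ ∣ r - s ∣
∣-∣-neighbours φ zero    zero    = refl
∣-∣-neighbours φ zero    (suc s) = +-comm (φ s) _
∣-∣-neighbours φ (suc r) zero    = cong (λ d → φ (suc (suc r)) + φ d) (∣-∣-identityʳ r)
∣-∣-neighbours φ (suc r) (suc s) = ∣-∣-neighbours φ r s

module Moments (u : ℕ) (z : Fin (suc u)) where

  gap : Vec (Fin (suc u)) n × Vec (Fin (suc u)) n → ℕ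
  gap (R , B) = ∣ mult z (toList R) - mult z (toList B) ∣

  -- (1 + u)^(2n) times the expectation of φ |D|, where D is the difference of the numbers of red and of blue points at z.
  moment : ℕ → (ℕ → ℕ) → ℕ
  moment n φ = sumMap (φ ∘ gap) (samplePairs (suc u) n)

  moment-cong : ∀ n {φ ψ} → (∀ d → φ d ≡ ψ d) → moment n φ ≡ moment n ψ
  moment-cong n φ≡ψ = sumMap-cong (samplePairs (suc u) n) (φ≡ψ ∘ gap)

  moment-+ : ∀ n φ ψ → moment n (λ d → φ d + ψ d) ≡ moment n φ + moment n ψ
  moment-+ n φ ψ = sumMap-+ (φ ∘ gap) (ψ ∘ gap) (samplePairs (suc u) n)

  moment-*ˡ : ∀ n c φ → moment n (λ d → c * φ d) ≡ c * moment n φ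
  moment-*ˡ n c φ = sumMap-*ˡ c (φ ∘ gap) (samplePairs (suc u) n)

  -- One more point of each colour moves D by +1 or -1 with u choices each, and leaves it with 1 + u² choices.
  moment-suc : ∀ n φ → moment (suc n) φ ≡ (1 + u * u) * moment n φ + u * moment n (neighbours φ)
  moment-suc n φ = begin
    moment (suc n) φ
      ≡⟨ sumMap-samplePairs-suc {suc u} {n} (φ ∘ gap) ⟩
    sumMap (λ (R , B) → sumMap (λ i → sumMap (λ j → φ (gap (i Vec.∷ R , j Vec.∷ B))) (allFin (suc u))) (allFin (suc u)))
           (samplePairs (suc u) n)
      ≡⟨ sumMap-cong (samplePairs (suc u) n) (λ (R , B) → step (mult z (toList R)) (mult z (toList B))) ⟩
    sumMap (λ p → (1 + u * u) * φ (gap p) + u * neighbours φ (gap p)) (samplePairs (suc u) n)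
      ≡⟨ sumMap-+ _ _ (samplePairs (suc u) n) ⟩
    sumMap (λ p → (1 + u * u) * φ (gap p)) (samplePairs (suc u) n) + sumMap (λ p → u * neighbours φ (gap p)) (samplePairs (suc u) n)
      ≡⟨ cong₂ _+_ (moment-*ˡ n (1 + u * u) φ) (moment-*ˡ n u (neighbours φ)) ⟩
    (1 + u * u) * moment n φ + u * moment n (neighbours φ) ∎
    where
    open ≡-Reasoning
    regroup : ∀ u A B C → A + u * B + u * (C + u * A) ≡ (1 + u * u) * A + u * (B + C)
    regroup = solve-∀
    step : ∀ r s → sumMap (λ i → sumMap (λ j → φ ∣ δ z i + r - (δ z j + s) ∣) (allFin (suc u))) (allFin (suc u))
                 ≡ (1 + u * u) * φ ∣ r - s ∣ + u * neighbours φ ∣ r - s ∣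
    step r s = begin
      sumMap (λ i → sumMap (λ j → φ ∣ δ z i + r - (δ z j + s) ∣) (allFin (suc u))) (allFin (suc u))
        ≡⟨ sumMap-cong (allFin (suc u)) (λ i → sumMap-∘δ (λ t → φ ∣ δ z i + r - (t + s) ∣) z) ⟩
      sumMap (λ i → φ ∣ δ z i + r - suc s ∣ + u * φ ∣ δ z i + r - s ∣) (allFin (suc u))
        ≡⟨ sumMap-∘δ (λ t → φ ∣ t + r - suc s ∣ + u * φ ∣ t + r - s ∣) z ⟩
      φ ∣ r - s ∣ + u * φ ∣ suc r - s ∣ + u * (φ ∣ r - suc s ∣ + u * φ ∣ r - s ∣)
        ≡⟨ regroup u (φ ∣ r - s ∣) (φ ∣ suc r - s ∣) (φ ∣ r - suc s ∣) ⟩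
      (1 + u * u) * φ ∣ r - s ∣ + u * (φ ∣ suc r - s ∣ + φ ∣ r - suc s ∣)
        ≡⟨ cong (λ m → (1 + u * u) * φ ∣ r - s ∣ + u * m) (∣-∣-neighbours φ r s) ⟩
      (1 + u * u) * φ ∣ r - s ∣ + u * neighbours φ ∣ r - s ∣ ∎

  M₀ M₁ M₂ M₄ : ℕ → ℕ
  M₀ n = moment n (λ _ → 1)
  M₁ n = moment n (λ d → d)
  M₂ n = moment n (λ d → d * d)
  M₄ n = moment n (λ d → (d * d) * (d * d))

  private
    β = suc u * suc u

    u≤β : u ≤ β
    u≤β = ≤-trans (n≤1+n u) (m≤m*n (suc u) (suc u))

  M₀-suc : ∀ n → M₀ (suc n) ≡ β * M₀ n
  M₀-suc n = begin
    M₀ (suc n)                              ≡⟨ moment-suc n (λ _ → 1) ⟩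
    (1 + u * u) * M₀ n + u * moment n (neighbours (λ _ → 1))
      ≡⟨ cong (λ m → (1 + u * u) * M₀ n + u * m)
              (trans (moment-cong n {neighbours (λ _ → 1)} {λ _ → 2 * 1} λ { zero → refl ; (suc _) → refl })
                     (moment-*ˡ n 2 (λ _ → 1))) ⟩
    (1 + u * u) * M₀ n + u * (2 * M₀ n)    ≡⟨ collect u (M₀ n) ⟩
    β * M₀ n                                ∎
    where
    open ≡-Reasoning
    collect : ∀ u M → (1 + u * u) * M + u * (2 * M) ≡ (1 + u) * (1 + u) * M
    collect = solve-∀

  M₀≡ : ∀ n → M₀ n ≡ suc u ^ (2 * n)
  M₀≡ zero    = refl
  M₀≡ (suc n) = begin
    M₀ (suc n)                           ≡⟨ M₀-suc n ⟩
    β * M₀ n                             ≡⟨ cong (β *_) (M₀≡ n) ⟩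
    β * suc u ^ (2 * n)                  ≡⟨ *-assoc (suc u) (suc u) _ ⟩
    suc u ^ (2 + 2 * n)                  ≡⟨ cong (suc u ^_) (*-suc 2 n) ⟨
    suc u ^ (2 * suc n)                  ∎
    where open ≡-Reasoning

  M₂-suc : ∀ n → M₂ (suc n) ≡ β * M₂ n + 2 * u * M₀ n
  M₂-suc n = begin
    M₂ (suc n)                                  ≡⟨ moment-suc n (λ d → d * d) ⟩
    (1 + u * u) * M₂ n + u * moment n (neighbours (λ d → d * d))
      ≡⟨ cong (λ m → (1 + u * u) * M₂ n + u * m) (begin
           moment n (neighbours (λ d → d * d))              ≡⟨ moment-cong n neighbours-square ⟩
           moment n (λ d → 2 * (d * d) + 2 * 1)             ≡⟨ moment-+ n (λ d → 2 * (d * d)) (λ _ → 2 * 1) ⟩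
           moment n (λ d → 2 * (d * d)) + moment n (λ _ → 2 * 1)
             ≡⟨ cong₂ _+_ (moment-*ˡ n 2 (λ d → d * d)) (moment-*ˡ n 2 (λ _ → 1)) ⟩
           2 * M₂ n + 2 * M₀ n                              ∎) ⟩
    (1 + u * u) * M₂ n + u * (2 * M₂ n + 2 * M₀ n)  ≡⟨ collect u (M₂ n) (M₀ n) ⟩
    β * M₂ n + 2 * u * M₀ n                         ∎
    where
    open ≡-Reasoning
    neighbours-square : ∀ d → neighbours (λ d → d * d) d ≡ 2 * (d * d) + 2 * 1
    neighbours-square zero    = refl
    neighbours-square (suc d) = square d
      where
      square : ∀ d → (2 + d) * (2 + d) + d * d ≡ 2 * ((1 + d) * (1 + d)) + 2 * 1
      square = solve-∀
    collect : ∀ u X M → (1 + u * u) * X + u * (2 * X + 2 * M) ≡ (1 + u) * (1 + u) * X + 2 * u * M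
    collect = solve-∀

  M₂≡ : ∀ n → β * M₂ n ≡ 2 * u * n * M₀ n
  M₂≡ zero    = trans (*-zeroʳ β) (sym (cong (_* M₀ zero) (*-zeroʳ (2 * u))))
  M₂≡ (suc n) = begin
    β * M₂ (suc n)                       ≡⟨ cong (β *_) (M₂-suc n) ⟩
    β * (β * M₂ n + 2 * u * M₀ n)        ≡⟨ *-distribˡ-+ β (β * M₂ n) (2 * u * M₀ n) ⟩
    β * (β * M₂ n) + β * (2 * u * M₀ n)  ≡⟨ cong (λ m → β * m + β * (2 * u * M₀ n)) (M₂≡ n) ⟩
    β * (2 * u * n * M₀ n) + β * (2 * u * M₀ n) ≡⟨ collect β u n (M₀ n) ⟩
    2 * u * suc n * (β * M₀ n)           ≡⟨ cong (2 * u * suc n *_) (M₀-suc n) ⟨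
    2 * u * suc n * M₀ (suc n)           ∎
    where
    open ≡-Reasoning
    collect : ∀ β u n M → β * (2 * u * n * M) + β * (2 * u * M) ≡ 2 * u * (1 + n) * (β * M)
    collect = solve-∀

  M₄-suc : ∀ n → M₄ (suc n) ≡ β * M₄ n + 12 * u * M₂ n + 2 * u * M₀ n
  M₄-suc n = begin
    M₄ (suc n)                                  ≡⟨ moment-suc n q⁴ ⟩
    (1 + u * u) * M₄ n + u * moment n (neighbours q⁴)
      ≡⟨ cong (λ m → (1 + u * u) * M₄ n + u * m) (begin
           moment n (neighbours q⁴)                           ≡⟨ moment-cong n neighbours-q⁴ ⟩
           moment n (λ d → 2 * q⁴ d + 12 * (d * d) + 2 * 1)
             ≡⟨ moment-+ n (λ d → 2 * q⁴ d + 12 * (d * d)) (λ _ → 2 * 1) ⟩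
           moment n (λ d → 2 * q⁴ d + 12 * (d * d)) + moment n (λ _ → 2 * 1)
             ≡⟨ cong (_+ moment n (λ _ → 2 * 1)) (moment-+ n (λ d → 2 * q⁴ d) (λ d → 12 * (d * d))) ⟩
           moment n (λ d → 2 * q⁴ d) + moment n (λ d → 12 * (d * d)) + moment n (λ _ → 2 * 1)
             ≡⟨ cong₂ _+_ (cong₂ _+_ (moment-*ˡ n 2 q⁴) (moment-*ˡ n 12 (λ d → d * d))) (moment-*ˡ n 2 (λ _ → 1)) ⟩
           2 * M₄ n + 12 * M₂ n + 2 * M₀ n                    ∎) ⟩
    (1 + u * u) * M₄ n + u * (2 * M₄ n + 12 * M₂ n + 2 * M₀ n) ≡⟨ collect u (M₄ n) (M₂ n) (M₀ n) ⟩
    β * M₄ n + 12 * u * M₂ n + 2 * u * M₀ n                    ∎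
    where
    open ≡-Reasoning
    q⁴ : ℕ → ℕ
    q⁴ d = (d * d) * (d * d)
    neighbours-q⁴ : ∀ d → neighbours q⁴ d ≡ 2 * q⁴ d + 12 * (d * d) + 2 * 1
    neighbours-q⁴ zero    = refl
    neighbours-q⁴ (suc d) = fourth d
      where
      fourth : ∀ d → ((2 + d) * (2 + d)) * ((2 + d) * (2 + d)) + (d * d) * (d * d)
                     ≡ 2 * (((1 + d) * (1 + d)) * ((1 + d) * (1 + d))) + 12 * ((1 + d) * (1 + d)) + 2 * 1
      fourth = solve-∀
    collect : ∀ u X Y M → (1 + u * u) * X + u * (2 * X + 12 * Y + 2 * M) ≡ (1 + u) * (1 + u) * X + 12 * u * Y + 2 * u * M
    collect = solve-∀

  -- E D⁴ = 2 n u / (1 + u)² + 12 n (n - 1) u² / (1 + u)⁴.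
  M₄≡ : ∀ n → β * β * M₄ n + 12 * (u * u) * n * M₀ n ≡ 2 * u * n * (β + 6 * u * n) * M₀ n
  M₄≡ zero    = zeros β u
    where
    zeros : ∀ β u → β * β * 0 + 12 * (u * u) * 0 * 1 ≡ 2 * u * 0 * (β + 6 * u * 0) * 1
    zeros = solve-∀
  M₄≡ (suc n) = begin
    β * β * M₄ (suc n) + 12 * (u * u) * suc n * M₀ (suc n)
      ≡⟨ cong₂ (λ p q → β * β * p + 12 * (u * u) * suc n * q) (M₄-suc n) (M₀-suc n) ⟩
    β * β * (β * M₄ n + 12 * u * M₂ n + 2 * u * M₀ n) + 12 * (u * u) * suc n * (β * M₀ n)
      ≡⟨ expand β u n (M₄ n) (M₂ n) (M₀ n) ⟩
    β * (β * β * M₄ n + 12 * (u * u) * n * M₀ n) + 12 * u * β * (β * M₂ n) + 2 * u * β * β * M₀ n + 12 * (u * u) * β * M₀ n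
      ≡⟨ cong₂ (λ p q → β * p + 12 * u * β * q + 2 * u * β * β * M₀ n + 12 * (u * u) * β * M₀ n) (M₄≡ n) (M₂≡ n) ⟩
    β * (2 * u * n * (β + 6 * u * n) * M₀ n) + 12 * u * β * (2 * u * n * M₀ n) + 2 * u * β * β * M₀ n + 12 * (u * u) * β * M₀ n
      ≡⟨ collect β u n (M₀ n) ⟩
    2 * u * suc n * (β + 6 * u * suc n) * (β * M₀ n)
      ≡⟨ cong (2 * u * suc n * (β + 6 * u * suc n) *_) (M₀-suc n) ⟨
    2 * u * suc n * (β + 6 * u * suc n) * M₀ (suc n) ∎
    where
    open ≡-Reasoning
    expand : ∀ β u n P Y M → β * β * (β * P + 12 * u * Y + 2 * u * M) + 12 * (u * u) * (1 + n) * (β * M)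
             ≡ β * (β * β * P + 12 * (u * u) * n * M) + 12 * u * β * (β * Y) + 2 * u * β * β * M + 12 * (u * u) * β * M
    expand = solve-∀
    collect : ∀ β u n M → β * (2 * u * n * (β + 6 * u * n) * M) + 12 * u * β * (2 * u * n * M)
                            + 2 * u * β * β * M + 12 * (u * u) * β * M
              ≡ 2 * u * (1 + n) * (β + 6 * u * (1 + n)) * (β * M)
    collect = solve-∀

  M₄≤ : ∀ n → β * β * M₄ n ≤ 14 * u * β * (n * n) * M₀ n
  M₄≤ n = begin
    β * β * M₄ n                                          ≤⟨ m≤m+n _ _ ⟩
    β * β * M₄ n + 12 * (u * u) * n * M₀ n                ≡⟨ M₄≡ n ⟩
    2 * u * n * (β + 6 * u * n) * M₀ n                    ≡⟨ expand u β n (M₀ n) ⟩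
    2 * u * β * (n * M₀ n) + 12 * (u * u) * (n * n) * M₀ n
      ≤⟨ +-mono-≤ (*-monoʳ-≤ (2 * u * β) (*-monoˡ-≤ (M₀ n) (n≤n*n n)))
                  (*-monoˡ-≤ (M₀ n) (*-monoˡ-≤ (n * n) (*-monoʳ-≤ 12 (*-monoʳ-≤ u u≤β)))) ⟩
    2 * u * β * (n * n * M₀ n) + 12 * (u * β) * (n * n) * M₀ n ≡⟨ collect u β n (M₀ n) ⟩
    14 * u * β * (n * n) * M₀ n                           ∎
    where
    open ≤-Reasoning
    expand : ∀ u β n M → 2 * u * n * (β + 6 * u * n) * M ≡ 2 * u * β * (n * M) + 12 * (u * u) * (n * n) * M
    expand = solve-∀
    collect : ∀ u β n M → 2 * u * β * (n * n * M) + 12 * (u * β) * (n * n) * M ≡ 14 * u * β * (n * n) * M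
    collect = solve-∀

  M₂≤ : ∀ n → M₂ n ≤ 2 * n * M₀ n
  M₂≤ n = *-cancelˡ-≤ β (begin
    β * M₂ n            ≡⟨ M₂≡ n ⟩
    2 * u * n * M₀ n    ≡⟨ shuffle u n (M₀ n) ⟩
    u * (2 * n * M₀ n)  ≤⟨ *-monoˡ-≤ (2 * n * M₀ n) u≤β ⟩
    β * (2 * n * M₀ n)  ∎)
    where
    open ≤-Reasoning
    shuffle : ∀ u n M → 2 * u * n * M ≡ u * (2 * n * M)
    shuffle = solve-∀

  M₁-upper : ∀ n → M₁ n * M₁ n ≤ 2 * n * (M₀ n * M₀ n)
  M₁-upper n = begin
    M₁ n * M₁ n                   ≤⟨ sumMap-sq≤ gap (samplePairs (suc u) n) ⟩
    length (samplePairs (suc u) n) * M₂ n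
      ≡⟨ cong (_* M₂ n) (trans (sym (*-identityʳ (length (samplePairs (suc u) n)))) (sym (sumMap-const 1 (samplePairs (suc u) n)))) ⟩
    M₀ n * M₂ n                   ≤⟨ *-monoʳ-≤ (M₀ n) (M₂≤ n) ⟩
    M₀ n * (2 * n * M₀ n)         ≡⟨ shuffle (M₀ n) n ⟩
    2 * n * (M₀ n * M₀ n)         ∎
    where
    open ≤-Reasoning
    shuffle : ∀ M n → M * (2 * n * M) ≡ 2 * n * (M * M)
    shuffle = solve-∀

  -- Hölder: E|D| ≥ (E D²)^(3/2) / (E D⁴)^(1/2), with E D² ≈ n and E D⁴ ≲ n²; K clears the denominators.
  M₁-lower : ∀ n → 0 < u → 0 < n → u * u * n * (M₀ n * M₀ n) ≤ 2 * (β * β) * (M₁ n * M₁ n)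
  M₁-lower n 0<u 0<n = *-cancelʳ-≤ _ _ K {{>-nonZero K>0}} (begin
    u * u * n * (M₀ n * M₀ n) * K
      ≡⟨ e₁ u n (M₀ n) β ⟩
    (2 * u * n * M₀ n) * (2 * u * n * M₀ n) * (2 * u * n * M₀ n) * (β * β)
      ≡⟨ cong (λ m → m * m * m * (β * β)) (M₂≡ n) ⟨
    (β * M₂ n) * (β * M₂ n) * (β * M₂ n) * (β * β)
      ≡⟨ e₂ β (M₂ n) ⟩
    β * β * β * (β * β) * (M₂ n * M₂ n * M₂ n)
      ≤⟨ *-monoʳ-≤ (β * β * β * (β * β)) (sumMap-holder gap (samplePairs (suc u) n)) ⟩
    β * β * β * (β * β) * (M₁ n * M₁ n * M₄ n)
      ≡⟨ e₃ β (M₁ n) (M₄ n) ⟩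
    β * β * β * (M₁ n * M₁ n) * (β * β * M₄ n)
      ≤⟨ *-monoʳ-≤ (β * β * β * (M₁ n * M₁ n)) (≤-trans (M₄≤ n)
           (*-monoˡ-≤ (M₀ n) (*-monoˡ-≤ (n * n) (*-monoˡ-≤ β (*-monoˡ-≤ u (m≤m+n 14 2)))))) ⟩
    β * β * β * (M₁ n * M₁ n) * (16 * u * β * (n * n) * M₀ n)
      ≡⟨ e₄ β (M₁ n) u n (M₀ n) ⟩
    2 * (β * β) * (M₁ n * M₁ n) * K ∎)
    where
    open ≤-Reasoning
    K = 8 * u * (n * n) * M₀ n * (β * β)
    K>0 : 0 < K
    K>0 = *-pos {8 * u * (n * n) * M₀ n} {β * β}
            (*-pos {8 * u * (n * n)} (*-pos {8 * u} (*-pos {8} (s≤s z≤n) 0<u) (*-pos {n} 0<n 0<n))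
                   (subst (0 <_) (sym (M₀≡ n)) (m^n>0 (suc u) (2 * n))))
            (*-pos {β} (s≤s z≤n) (s≤s z≤n))
    e₁ : ∀ u n M β → u * u * n * (M * M) * (8 * u * (n * n) * M * (β * β))
                     ≡ (2 * u * n * M) * (2 * u * n * M) * (2 * u * n * M) * (β * β)
    e₁ = solve-∀
    e₂ : ∀ β X → (β * X) * (β * X) * (β * X) * (β * β) ≡ β * β * β * (β * β) * (X * X * X)
    e₂ = solve-∀
    e₃ : ∀ β A P → β * β * β * (β * β) * (A * A * P) ≡ β * β * β * (A * A) * (β * β * P)
    e₃ = solve-∀
    e₄ : ∀ β A u n M → β * β * β * (A * A) * (16 * u * β * (n * n) * M) ≡ 2 * (β * β) * (A * A) * (8 * u * (n * n) * M * (β * β))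
    e₄ = solve-∀

module _ (u : ℕ) where

  open Moments u using (M₀; M₁; gap)

  private
    pairs = samplePairs (suc u)

  totalCost≥M₁ : ∀ (z : Fin (suc u)) n → 4 * M₁ z n ≤ totalCost (suc u) n
  totalCost≥M₁ z n = begin
    4 * M₁ z n                                  ≡⟨ sumMap-*ˡ 4 (gap z) (pairs n) ⟨
    sumMap (λ p → 4 * gap z p) (pairs n)        ≤⟨ sumMap-mono (pairs n) (λ (R , B) → optTour-≥-mult z R B) ⟩
    sumMap (uncurry optTour) (pairs n)          ≡⟨ totalCost≡sumMap-optTour (suc u) n ⟨
    totalCost (suc u) n                         ∎
    where open ≤-Reasoning

  totalCost≤M₁ : ∀ n → totalCost (suc u) n ≤ 4 * sumMap (λ i → M₁ i n) (allFin (suc u)) + (4 * suc u + 4) * M₀ zero n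
  totalCost≤M₁ n = begin
    totalCost (suc u) n
      ≡⟨ totalCost≡sumMap-optTour (suc u) n ⟩
    sumMap (uncurry optTour) (pairs n)
      ≤⟨ sumMap-mono (pairs n) (λ (R , B) → ≤-trans (optTour≤imbalance R B) (≤-reflexive (+-assoc _ (4 * suc u) 4))) ⟩
    sumMap (λ p → 4 * sumMap (λ i → gap i p) (allFin (suc u)) + (4 * suc u + 4)) (pairs n)
      ≡⟨ sumMap-+ _ _ (pairs n) ⟩
    sumMap (λ p → 4 * sumMap (λ i → gap i p) (allFin (suc u))) (pairs n) + sumMap (λ _ → 4 * suc u + 4) (pairs n)
      ≡⟨ cong₂ _+_ (sumMap-*ˡ 4 _ (pairs n))
                   (trans (sumMap-cong (pairs n) (λ _ → sym (*-identityʳ (4 * suc u + 4)))) (sumMap-*ˡ (4 * suc u + 4) _ (pairs n))) ⟩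
    4 * sumMap (λ p → sumMap (λ i → gap i p) (allFin (suc u))) (pairs n) + (4 * suc u + 4) * M₀ zero n
      ≡⟨ cong (λ m → 4 * m + (4 * suc u + 4) * M₀ zero n) (sumMap-swap (λ p i → gap i p) (pairs n) (allFin (suc u))) ⟩
    4 * sumMap (λ i → M₁ i n) (allFin (suc u)) + (4 * suc u + 4) * M₀ zero n ∎
    where open ≤-Reasoning

totalCost-lower : ∀ b → 2 ≤ b → ∀ n → 1 ≤ n →
                  n * (b ^ (2 * n) * b ^ (2 * n)) ≤ b * b * (b * b) * (totalCost b n * totalCost b n)
totalCost-lower (suc zero) (s≤s ()) _ _
totalCost-lower b@(suc u@(suc _)) _ n 1≤n = begin
  n * (b ^ (2 * n) * b ^ (2 * n))      ≡⟨ cong (λ q → n * (q * q)) (M₀≡ n) ⟨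
  n * (M₀ n * M₀ n)                    ≤⟨ *-monoˡ-≤ (M₀ n * M₀ n) (m≤n*m n (u * u)) ⟩
  u * u * n * (M₀ n * M₀ n)            ≤⟨ M₁-lower n (s≤s z≤n) 1≤n ⟩
  2 * (β * β) * (M₁ n * M₁ n)          ≤⟨ *-monoˡ-≤ (M₁ n * M₁ n) (*-monoˡ-≤ (β * β) (m≤m+n 2 14)) ⟩
  16 * (β * β) * (M₁ n * M₁ n)         ≡⟨ square-4 β (M₁ n) ⟩
  β * β * ((4 * M₁ n) * (4 * M₁ n))
    ≤⟨ *-monoʳ-≤ (β * β) (*-mono-≤ (totalCost≥M₁ u zero n) (totalCost≥M₁ u zero n)) ⟩
  β * β * (totalCost b n * totalCost b n) ∎
  where
  open ≤-Reasoning
  open Moments u zero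
  β = b * b
  square-4 : ∀ β A → 16 * (β * β) * (A * A) ≡ β * β * ((4 * A) * (4 * A))
  square-4 = solve-∀

totalCost-upper : ∀ b → 1 ≤ b → ∀ n → 1 ≤ n →
                  totalCost b n * totalCost b n ≤ 16 * b * (16 * b) * n * (b ^ (2 * n) * b ^ (2 * n))
totalCost-upper b@(suc u) _ n 1≤n = subst (λ q → T * T ≤ 16 * b * (16 * b) * n * (q * q)) (M₀≡ zero n) (begin
  T * T                                          ≤⟨ *-mono-≤ T≤ T≤ ⟩
  (4 * W + 8 * b * Q) * (4 * W + 8 * b * Q)      ≤⟨ [m+n]²≤2m²+2n² (4 * W) (8 * b * Q) ⟩
  2 * ((4 * W) * (4 * W)) + 2 * ((8 * b * Q) * (8 * b * Q))
    ≡⟨ expand W b Q ⟩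
  32 * (W * W) + 128 * (b * b) * (Q * Q)
    ≤⟨ +-mono-≤ (*-monoʳ-≤ 32 W²≤) (*-monoˡ-≤ (Q * Q) (*-monoˡ-≤ (b * b) (*-monoʳ-≤ 128 1≤n))) ⟩
  32 * (2 * n * (b * b) * (Q * Q)) + 128 * n * (b * b) * (Q * Q)
    ≡⟨ collect n b Q ⟩
  192 * n * (b * b) * (Q * Q)                    ≤⟨ *-monoˡ-≤ (Q * Q) (*-monoˡ-≤ (b * b) (*-monoˡ-≤ n (m≤m+n 192 64))) ⟩
  256 * n * (b * b) * (Q * Q)                    ≡⟨ regroup n b Q ⟩
  16 * b * (16 * b) * n * (Q * Q)                ∎)
  where
  open ≤-Reasoning
  open Moments u
  T = totalCost b n
  Q = M₀ zero n
  W = sumMap (λ i → M₁ i n) (allFin b)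
  T≤ : T ≤ 4 * W + 8 * b * Q
  T≤ = ≤-trans (totalCost≤M₁ u n) (+-monoʳ-≤ (4 * W) (*-monoˡ-≤ Q (≤-trans (+-monoʳ-≤ (4 * b) (*-monoʳ-≤ 4 (s≤s z≤n)))
                                                                       (≤-reflexive (twice b)))))
    where
    twice : ∀ b → 4 * b + 4 * b ≡ 8 * b
    twice = solve-∀
  W²≤ : W * W ≤ 2 * n * (b * b) * (Q * Q)
  W²≤ = begin
    W * W                                                ≤⟨ sumMap-sq≤ (λ i → M₁ i n) (allFin b) ⟩
    length (allFin b) * sumMap (λ i → M₁ i n * M₁ i n) (allFin b)
      ≤⟨ *-monoʳ-≤ (length (allFin b)) (sumMap-mono (allFin b) (λ i → M₁-upper i n)) ⟩
    length (allFin b) * sumMap (λ _ → 2 * n * (Q * Q)) (allFin b)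
      ≡⟨ cong₂ _*_ (length-allFin b)
                   (trans (sumMap-const _ (allFin b)) (cong (_* (2 * n * (Q * Q))) (length-allFin b))) ⟩
    b * (b * (2 * n * (Q * Q)))                          ≡⟨ regroup′ b n Q ⟩
    2 * n * (b * b) * (Q * Q)                            ∎
    where
    regroup′ : ∀ b n Q → b * (b * (2 * n * (Q * Q))) ≡ 2 * n * (b * b) * (Q * Q)
    regroup′ = solve-∀
  expand : ∀ W b Q → 2 * ((4 * W) * (4 * W)) + 2 * ((8 * b * Q) * (8 * b * Q)) ≡ 32 * (W * W) + 128 * (b * b) * (Q * Q)
  expand = solve-∀
  collect : ∀ n b Q → 32 * (2 * n * (b * b) * (Q * Q)) + 128 * n * (b * b) * (Q * Q) ≡ 192 * n * (b * b) * (Q * Q)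
  collect = solve-∀
  regroup : ∀ n b Q → 256 * n * (b * b) * (Q * Q) ≡ 16 * b * (16 * b) * n * (Q * Q)
  regroup = solve-∀

proposition4 : (b : ℕ) → 2 ≤ b →
    ∃[ a ] ∃[ d ] ∃[ N ] (1 ≤ d × (∀ n → N ≤ n →
    (n * (b ^ (2 * n) * b ^ (2 * n)) ≤ d * d * (totalCost b n * totalCost b n))
    × (totalCost b n * totalCost b n ≤ a * a * n * (b ^ (2 * n) * b ^ (2 * n)))))
proposition4 b 2≤b = 16 * b , b * b , 1 , 1≤b*b , λ n 1≤n →
  totalCost-lower b 2≤b n 1≤n , totalCost-upper b 1≤b n 1≤n
  where
  1≤b : 1 ≤ b
  1≤b = <⇒≤ 2≤b
  1≤b*b : 1 ≤ b * b
  1≤b*b = *-mono-≤ 1≤b 1≤b
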